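{- There do not exist equilateral triangles in an AL-monoid $A$: if $a,b,c\in A$ satisfy $a\ast b=b\ast c=c\ast a$, then $a=b=c$.
   Context: An AL-monoid (autometrized lattice ordered monoid) is an algebra $(A,+,\vee,\wedge,\ast,0)$ of type $(2,2,2,2,0)$ such that: (1) $(A,+,\vee,\wedge,0)$ is a commutative lattice ordered monoid, i.e. $(A,+,0)$ is a commutative monoid with identity $0$, $(A,\vee,\wedge)$ is a lattice with induced order $\leq$, and $a+(b\vee c)=(a+b)\vee(a+c)$, $a+(b\wedge c)=(a+b)\wedge(a+c)$; (2) $a\ast(a\wedge b)+b=a\vee b$ for all $a,b$; (3) for each $a\in A$ the maps $x\mapsto a+x$, $x\mapsto a\vee x$, $x\mapsto a\wedge x$, $x\mapsto a\ast x$ are contractions with respect to $\ast$, i.e. $f(x)\ast f(y)\leq x\ast y$ for all $x,y$; (4) $[a\ast(a\vee b)]\wedge[b\ast(a\vee b)]=0$ for all $a,b$; and $\ast$ is a metric operation: $a\ast b\geq 0$ with equality iff $a=b$, $a\ast b=b\ast a$, and $a\ast b\leq a\ast c+c\ast b$ for all $a,b,c$. -}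

module Defs where

open import Level using (Level; suc; _⊔_)
open import Relation.Binary.PropositionalEquality using (_≡_)
open import Data.Product using (_×_)
open import Function.Bundles using (_⇔_)

-- An AL-monoid (autometrized lattice ordered monoid) on a carrier A,
-- with equality the propositional equality of A.
-- The order is the lattice order induced by ∨: x ≤ y iff x ∨ y ≡ y.
record ALMonoid (a : Level) : Set (suc a) where
  infixl 6 _+_
  infixr 7 _∨_
  infixr 8 _∧_
  infixl 9 _*_
  infix 4 _≤_
  field
    A   : Set a
    _+_ : A → A → A
    _∨_ : A → A → A
    _∧_ : A → A → A
    _*_ : A → A → A
    0#  : A

  _≤_ : A → A → Set a
  x ≤ y = (x ∨ y) ≡ y

  field
    +-assoc    : ∀ x y z → (x + y) + z ≡ x + (y + z)
    +-comm     : ∀ x y → x + y ≡ y + x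
    +-identityˡ : ∀ x → 0# + x ≡ x
    ∨-comm     : ∀ x y → x ∨ y ≡ y ∨ x
    ∨-assoc    : ∀ x y z → (x ∨ y) ∨ z ≡ x ∨ (y ∨ z)
    ∧-comm     : ∀ x y → x ∧ y ≡ y ∧ x
    ∧-assoc    : ∀ x y z → (x ∧ y) ∧ z ≡ x ∧ (y ∧ z)
    ∨-absorbs-∧ : ∀ x y → x ∨ (x ∧ y) ≡ x
    ∧-absorbs-∨ : ∀ x y → x ∧ (x ∨ y) ≡ x
    +-distrib-∨ : ∀ x y z → x + (y ∨ z) ≡ (x + y) ∨ (x + z)
    +-distrib-∧ : ∀ x y z → x + (y ∧ z) ≡ (x + y) ∧ (x + z)
    ax2 : ∀ x y → (x * (x ∧ y)) + y ≡ x ∨ y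
    +-contr : ∀ x u v → ((x + u) * (x + v)) ≤ (u * v)
    ∨-contr : ∀ x u v → ((x ∨ u) * (x ∨ v)) ≤ (u * v)
    ∧-contr : ∀ x u v → ((x ∧ u) * (x ∧ v)) ≤ (u * v)
    *-contr : ∀ x u v → ((x * u) * (x * v)) ≤ (u * v)
    ax4 : ∀ x y → ((x * (x ∨ y)) ∧ (y * (x ∨ y))) ≡ 0#
    *-nonneg : ∀ x y → 0# ≤ (x * y)
    *-zero⇔  : ∀ x y → ((x * y) ≡ 0#) ⇔ (x ≡ y)
    *-sym    : ∀ x y → x * y ≡ y * x
    *-triangle : ∀ x y z → (x * y) ≤ ((x * z) + (z * y))

-- Let d be the common side length, m = a ∧ b ∧ c and M = a ∨ b ∨ c. Since x ≤ x * y + y,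
-- every vertex lies below d + m, so M * m ≤ d. As x * y ≤ (x ∨ y) * m for every common lower
-- bound m, and y ↦ y * m is injective above m, any two vertices have join M. Axiom (4) then
-- splits each side as d = M * x + M * y with M * x ∧ M * y = 0, and these three splittings
-- force M * a = M * b = d, whence d = M * a ∧ M * b = 0.
module Submission where

open import Defs
open import Level using (Level)
open import Relation.Binary.PropositionalEquality
  using (_≡_; refl; sym; trans; cong; cong₂; subst; subst₂; isEquivalence; module ≡-Reasoning)
open import Data.Product using (_×_; _,_)
open import Function.Bundles using (Equivalence)
open import Algebra.Lattice.Bundles using (Lattice)
import Algebra.Lattice.Properties.Lattice as LatticeProperties
open import Relation.Binary.Bundles using (Poset)
import Relation.Binary.Reasoning.PartialOrder as PosetReasoning

module ALMonoidProperties {ℓ : Level} (𝓜 : ALMonoid ℓ) where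
  open ALMonoid 𝓜

  lattice : Lattice ℓ ℓ
  lattice = record
    { Carrier   = A
    ; _≈_       = _≡_
    ; _∨_       = _∨_
    ; _∧_       = _∧_
    ; isLattice = record
      { isEquivalence = isEquivalence
      ; ∨-comm        = ∨-comm
      ; ∨-assoc       = ∨-assoc
      ; ∨-cong        = cong₂ _∨_
      ; ∧-comm        = ∧-comm
      ; ∧-assoc       = ∧-assoc
      ; ∧-cong        = cong₂ _∧_
      ; absorptive    = ∨-absorbs-∧ , ∧-absorbs-∨
      }
    }

  open LatticeProperties lattice using (∨-idem; ∧-idem)

  ≤-reflexive : ∀ {x y} → x ≡ y → x ≤ y
  ≤-reflexive {x} refl = ∨-idem x

  ≤-trans : ∀ {x y z} → x ≤ y → y ≤ z → x ≤ z
  ≤-trans {x} {y} {z} x≤y y≤z = begin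
    x ∨ z        ≡⟨ cong (x ∨_) y≤z ⟨
    x ∨ (y ∨ z)  ≡⟨ ∨-assoc x y z ⟨
    (x ∨ y) ∨ z  ≡⟨ cong (_∨ z) x≤y ⟩
    y ∨ z        ≡⟨ y≤z ⟩
    z            ∎
    where open ≡-Reasoning

  ≤-antisym : ∀ {x y} → x ≤ y → y ≤ x → x ≡ y
  ≤-antisym {x} {y} x≤y y≤x = trans (sym y≤x) (trans (∨-comm y x) x≤y)

  poset : Poset ℓ ℓ ℓ
  poset = record
    { Carrier        = A
    ; _≈_            = _≡_
    ; _≤_            = _≤_
    ; isPartialOrder = record
      { isPreorder = record
        { isEquivalence = isEquivalence
        ; reflexive     = ≤-reflexive
        ; trans         = ≤-trans
        }
      ; antisym    = ≤-antisym
      }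
    }

  module ≤-Reasoning = PosetReasoning poset

  ≤⇒∧≡ : ∀ {x y} → x ≤ y → x ∧ y ≡ x
  ≤⇒∧≡ {x} {y} x≤y = trans (cong (x ∧_) (sym x≤y)) (∧-absorbs-∨ x y)

  ≤⇒∧≡′ : ∀ {x y} → x ≤ y → y ∧ x ≡ x
  ≤⇒∧≡′ {x} {y} x≤y = trans (∧-comm y x) (≤⇒∧≡ x≤y)

  ∧≡⇒≤ : ∀ {x y} → x ∧ y ≡ x → x ≤ y
  ∧≡⇒≤ {x} {y} x∧y≡x = begin
    x ∨ y        ≡⟨ cong (_∨ y) x∧y≡x ⟨
    (x ∧ y) ∨ y  ≡⟨ ∨-comm (x ∧ y) y ⟩
    y ∨ (x ∧ y)  ≡⟨ cong (y ∨_) (∧-comm x y) ⟩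
    y ∨ (y ∧ x)  ≡⟨ ∨-absorbs-∧ y x ⟩
    y            ∎
    where open ≡-Reasoning

  x≤x∨y : ∀ x y → x ≤ x ∨ y
  x≤x∨y x y = trans (sym (∨-assoc x x y)) (cong (_∨ y) (∨-idem x))

  y≤x∨y : ∀ x y → y ≤ x ∨ y
  y≤x∨y x y = subst (y ≤_) (∨-comm y x) (x≤x∨y y x)

  ∨-least : ∀ {x y z} → x ≤ z → y ≤ z → x ∨ y ≤ z
  ∨-least {x} {y} {z} x≤z y≤z = trans (∨-assoc x y z) (trans (cong (x ∨_) y≤z) x≤z)

  x∧y≤x : ∀ x y → x ∧ y ≤ x
  x∧y≤x x y = ∧≡⇒≤ (begin
    (x ∧ y) ∧ x  ≡⟨ ∧-assoc x y x ⟩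
    x ∧ (y ∧ x)  ≡⟨ cong (x ∧_) (∧-comm y x) ⟩
    x ∧ (x ∧ y)  ≡⟨ ∧-assoc x x y ⟨
    (x ∧ x) ∧ y  ≡⟨ cong (_∧ y) (∧-idem x) ⟩
    x ∧ y        ∎)
    where open ≡-Reasoning

  x∧y≤y : ∀ x y → x ∧ y ≤ y
  x∧y≤y x y = subst (_≤ y) (∧-comm y x) (x∧y≤x y x)

  ∧-greatest : ∀ {x y z} → x ≤ y → x ≤ z → x ≤ y ∧ z
  ∧-greatest {x} {y} {z} x≤y x≤z =
    ∧≡⇒≤ (trans (sym (∧-assoc x y z)) (trans (cong (_∧ z) (≤⇒∧≡ x≤y)) (≤⇒∧≡ x≤z)))

  +-identityʳ : ∀ x → x + 0# ≡ x
  +-identityʳ x = trans (+-comm x 0#) (+-identityˡ x)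

  +-monoˡ-≤ : ∀ z {x y} → x ≤ y → x + z ≤ y + z
  +-monoˡ-≤ z {x} {y} x≤y = begin
    (x + z) ∨ (y + z)  ≡⟨ cong₂ _∨_ (+-comm x z) (+-comm y z) ⟩
    (z + x) ∨ (z + y)  ≡⟨ +-distrib-∨ z x y ⟨
    z + (x ∨ y)        ≡⟨ cong (z +_) x≤y ⟩
    z + y              ≡⟨ +-comm z y ⟩
    y + z              ∎
    where open ≡-Reasoning

  x≤y+x : ∀ {y} x → 0# ≤ y → x ≤ y + x
  x≤y+x {y} x 0≤y = subst (_≤ y + x) (+-identityˡ x) (+-monoˡ-≤ x 0≤y)

  x+y≡d→x+z≡d→y∧z≡0→x≡d : ∀ {x y z d} → x + y ≡ d → x + z ≡ d → y ∧ z ≡ 0# → x ≡ d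
  x+y≡d→x+z≡d→y∧z≡0→x≡d {x} {y} {z} {d} x+y≡d x+z≡d y∧z≡0 = begin
    x                  ≡⟨ +-identityʳ x ⟨
    x + 0#             ≡⟨ cong (x +_) y∧z≡0 ⟨
    x + (y ∧ z)        ≡⟨ +-distrib-∧ x y z ⟩
    (x + y) ∧ (x + z)  ≡⟨ cong₂ _∧_ x+y≡d x+z≡d ⟩
    d ∧ d              ≡⟨ ∧-idem d ⟩
    d                  ∎
    where open ≡-Reasoning

  x*y+y≡x : ∀ {x y} → y ≤ x → x * y + y ≡ x
  x*y+y≡x {x} {y} y≤x = begin
    x * y + y        ≡⟨ cong (λ t → x * t + y) (≤⇒∧≡′ y≤x) ⟨
    x * (x ∧ y) + y  ≡⟨ ax2 x y ⟩
    x ∨ y            ≡⟨ ∨-comm x y ⟩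
    y ∨ x            ≡⟨ y≤x ⟩
    x                ∎
    where open ≡-Reasoning

  x*0≡x : ∀ {x} → 0# ≤ x → x * 0# ≡ x
  x*0≡x {x} 0≤x = trans (sym (+-identityʳ (x * 0#))) (x*y+y≡x 0≤x)

  *-cancelʳ-≡ : ∀ {x y z} → x ≤ y → x ≤ z → y * x ≡ z * x → y ≡ z
  *-cancelʳ-≡ {x} x≤y x≤z y*x≡z*x =
    trans (sym (x*y+y≡x x≤y)) (trans (cong (_+ x) y*x≡z*x) (x*y+y≡x x≤z))

  0≤x→x∧y≡0→x+y≡x∨y : ∀ {x y} → 0# ≤ x → x ∧ y ≡ 0# → x + y ≡ x ∨ y
  0≤x→x∧y≡0→x+y≡x∨y {x} {y} 0≤x x∧y≡0 = begin
    x + y            ≡⟨ cong (_+ y) (x*0≡x 0≤x) ⟨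
    x * 0# + y       ≡⟨ cong (λ t → x * t + y) x∧y≡0 ⟨
    x * (x ∧ y) + y  ≡⟨ ax2 x y ⟩
    x ∨ y            ∎
    where open ≡-Reasoning

  [x∨y]*y≤x*y : ∀ x y → (x ∨ y) * y ≤ x * y
  [x∨y]*y≤x*y x y = subst₂ _≤_ (cong₂ _*_ (∨-comm y x) (∨-idem y)) refl (∨-contr y x y)

  [x∨y]*x≤x*y : ∀ x y → (x ∨ y) * x ≤ x * y
  [x∨y]*x≤x*y x y = subst₂ _≤_ (cong (_* x) (∨-comm y x)) (*-sym y x) ([x∨y]*y≤x*y y x)

  x≤x*y+y : ∀ x y → x ≤ x * y + y
  x≤x*y+y x y = begin
    x                  ≤⟨ x≤x∨y x y ⟩
    x ∨ y              ≡⟨ x*y+y≡x (y≤x∨y x y) ⟨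
    (x ∨ y) * y + y    ≤⟨ +-monoˡ-≤ y ([x∨y]*y≤x*y x y) ⟩
    x * y + y          ∎
    where open ≤-Reasoning

  x≤y≤z⇒z*y≤z*x : ∀ {x y z} → x ≤ y → y ≤ z → z * y ≤ z * x
  x≤y≤z⇒z*y≤z*x {x} {y} {z} x≤y y≤z = subst₂ _≤_
    (trans (cong₂ _*_ (trans (∨-comm y x) x≤y) y≤z) (*-sym y z)) (*-sym x z) (∨-contr y x z)

  x≤y≤z⇒y*x≤z*x : ∀ {x y z} → x ≤ y → y ≤ z → y * x ≤ z * x
  x≤y≤z⇒y*x≤z*x {x} {y} {z} x≤y y≤z = subst₂ _≤_
    (trans (cong₂ _*_ (≤⇒∧≡′ x≤y) (≤⇒∧≡ y≤z)) (*-sym x y)) (*-sym x z) (∧-contr y x z)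

  x≤y≤d+x⇒y*x≤d : ∀ {x y d} → x ≤ y → y ≤ d + x → 0# ≤ d → y * x ≤ d
  x≤y≤d+x⇒y*x≤d {x} {y} {d} x≤y y≤d+x 0≤d = begin
    y * x                    ≡⟨ cong₂ _*_ (≤⇒∧≡ y≤d+x) (≤⇒∧≡′ x≤y) ⟨
    (y ∧ (d + x)) * (y ∧ x)  ≤⟨ ∧-contr y (d + x) x ⟩
    (d + x) * x              ≡⟨ cong₂ _*_ (+-comm x d) (+-identityʳ x) ⟨
    (x + d) * (x + 0#)       ≤⟨ +-contr x d 0# ⟩
    d * 0#                   ≡⟨ x*0≡x 0≤d ⟩
    d                        ∎
    where open ≤-Reasoning

  ∨-*-orthogonal : ∀ x y → (x ∨ y) * x ∧ (x ∨ y) * y ≡ 0#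
  ∨-*-orthogonal x y = trans (cong₂ _∧_ (*-sym (x ∨ y) x) (*-sym (x ∨ y) y)) (ax4 x y)

  *≡∨-*+∨-* : ∀ x y → x * y ≡ (x ∨ y) * x + (x ∨ y) * y
  *≡∨-*+∨-* x y = ≤-antisym
    (subst (x * y ≤_) (cong (_+ (x ∨ y) * y) (*-sym x (x ∨ y))) (*-triangle x y (x ∨ y)))
    (begin
      (x ∨ y) * x + (x ∨ y) * y  ≡⟨ 0≤x→x∧y≡0→x+y≡x∨y (*-nonneg (x ∨ y) x) (∨-*-orthogonal x y) ⟩
      (x ∨ y) * x ∨ (x ∨ y) * y  ≤⟨ ∨-least ([x∨y]*x≤x*y x y) ([x∨y]*y≤x*y x y) ⟩
      x * y                      ∎)
    where open ≤-Reasoning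

  *≡∨-*∨∨-* : ∀ x y → x * y ≡ (x ∨ y) * x ∨ (x ∨ y) * y
  *≡∨-*∨∨-* x y =
    trans (*≡∨-*+∨-* x y) (0≤x→x∧y≡0→x+y≡x∨y (*-nonneg (x ∨ y) x) (∨-*-orthogonal x y))

  m≤x→m≤y→x*y≤[x∨y]*m : ∀ {m x y} → m ≤ x → m ≤ y → x * y ≤ (x ∨ y) * m
  m≤x→m≤y→x*y≤[x∨y]*m {m} {x} {y} m≤x m≤y = begin
    x * y                      ≡⟨ *≡∨-*∨∨-* x y ⟩
    (x ∨ y) * x ∨ (x ∨ y) * y  ≤⟨ ∨-least (x≤y≤z⇒z*y≤z*x m≤x (x≤x∨y x y))
                                          (x≤y≤z⇒z*y≤z*x m≤y (y≤x∨y x y)) ⟩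
    (x ∨ y) * m                ∎
    where open ≤-Reasoning

  module EquilateralTriangle {a b c d : A} (a*b≡d : a * b ≡ d) (b*c≡d : b * c ≡ d) (c*a≡d : c * a ≡ d)
    where

    m M : A
    m = a ∧ b ∧ c
    M = a ∨ b ∨ c

    0≤d : 0# ≤ d
    0≤d = subst (0# ≤_) a*b≡d (*-nonneg a b)

    m≤a : m ≤ a
    m≤a = x∧y≤x a (b ∧ c)

    m≤b : m ≤ b
    m≤b = ≤-trans (x∧y≤y a (b ∧ c)) (x∧y≤x b c)

    m≤c : m ≤ c
    m≤c = ≤-trans (x∧y≤y a (b ∧ c)) (x∧y≤y b c)

    a≤M : a ≤ M
    a≤M = x≤x∨y a (b ∨ c)

    b≤M : b ≤ M
    b≤M = ≤-trans (x≤x∨y b c) (y≤x∨y a (b ∨ c))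

    c≤M : c ≤ M
    c≤M = ≤-trans (y≤x∨y b c) (y≤x∨y a (b ∨ c))

    x*y≡d→x≤d+y : ∀ {x y} → x * y ≡ d → x ≤ d + y
    x*y≡d→x≤d+y {x} {y} x*y≡d = subst (λ t → x ≤ t + y) x*y≡d (x≤x*y+y x y)

    ≤d+a→≤d+b→≤d+c→≤d+m : ∀ {x} → x ≤ d + a → x ≤ d + b → x ≤ d + c → x ≤ d + m
    ≤d+a→≤d+b→≤d+c→≤d+m {x} p q r = subst (x ≤_) (sym d+m≡) (∧-greatest p (∧-greatest q r))
      where
      d+m≡ : d + m ≡ (d + a) ∧ (d + b) ∧ (d + c)
      d+m≡ = trans (+-distrib-∧ d a (b ∧ c)) (cong ((d + a) ∧_) (+-distrib-∧ d b c))

    M≤d+m : M ≤ d + m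
    M≤d+m = ∨-least
      (≤d+a→≤d+b→≤d+c→≤d+m (x≤y+x a 0≤d) (x*y≡d→x≤d+y a*b≡d) (x*y≡d→x≤d+y a*c≡d))
      (∨-least
        (≤d+a→≤d+b→≤d+c→≤d+m (x*y≡d→x≤d+y b*a≡d) (x≤y+x b 0≤d) (x*y≡d→x≤d+y b*c≡d))
        (≤d+a→≤d+b→≤d+c→≤d+m (x*y≡d→x≤d+y c*a≡d) (x*y≡d→x≤d+y c*b≡d) (x≤y+x c 0≤d)))
      where
      b*a≡d : b * a ≡ d
      b*a≡d = trans (*-sym b a) a*b≡d
      c*b≡d : c * b ≡ d
      c*b≡d = trans (*-sym c b) b*c≡d
      a*c≡d : a * c ≡ d
      a*c≡d = trans (*-sym a c) c*a≡d

    M*m≤d : M * m ≤ d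
    M*m≤d = x≤y≤d+x⇒y*x≤d (≤-trans m≤a a≤M) M≤d+m 0≤d

    x∨y≡M : ∀ {x y} → m ≤ x → m ≤ y → x ≤ M → y ≤ M → x * y ≡ d → x ∨ y ≡ M
    x∨y≡M {x} {y} m≤x m≤y x≤M y≤M x*y≡d =
      *-cancelʳ-≡ m≤x∨y (≤-trans m≤x∨y x∨y≤M)
        (≤-antisym (x≤y≤z⇒y*x≤z*x m≤x∨y x∨y≤M) M*m≤[x∨y]*m)
      where
      open ≤-Reasoning
      m≤x∨y : m ≤ x ∨ y
      m≤x∨y = ≤-trans m≤x (x≤x∨y x y)
      x∨y≤M : x ∨ y ≤ M
      x∨y≤M = ∨-least x≤M y≤M
      M*m≤[x∨y]*m : M * m ≤ (x ∨ y) * m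
      M*m≤[x∨y]*m = begin
        M * m        ≤⟨ M*m≤d ⟩
        d            ≡⟨ x*y≡d ⟨
        x * y        ≤⟨ m≤x→m≤y→x*y≤[x∨y]*m m≤x m≤y ⟩
        (x ∨ y) * m  ∎

    a∨b≡M : a ∨ b ≡ M
    a∨b≡M = x∨y≡M m≤a m≤b a≤M b≤M a*b≡d

    b∨c≡M : b ∨ c ≡ M
    b∨c≡M = x∨y≡M m≤b m≤c b≤M c≤M b*c≡d

    c∨a≡M : c ∨ a ≡ M
    c∨a≡M = x∨y≡M m≤c m≤a c≤M a≤M c*a≡d

    M*x+M*y≡d : ∀ {x y} → x ∨ y ≡ M → x * y ≡ d → M * x + M * y ≡ d
    M*x+M*y≡d {x} {y} x∨y≡M x*y≡d =
      subst (λ e → e * x + e * y ≡ d) x∨y≡M (trans (sym (*≡∨-*+∨-* x y)) x*y≡d)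

    M*x∧M*y≡0 : ∀ {x y} → x ∨ y ≡ M → M * x ∧ M * y ≡ 0#
    M*x∧M*y≡0 {x} {y} x∨y≡M = subst (λ e → e * x ∧ e * y ≡ 0#) x∨y≡M (∨-*-orthogonal x y)

    M*a≡d : M * a ≡ d
    M*a≡d = x+y≡d→x+z≡d→y∧z≡0→x≡d (M*x+M*y≡d a∨b≡M a*b≡d)
      (trans (+-comm (M * a) (M * c)) (M*x+M*y≡d c∨a≡M c*a≡d)) (M*x∧M*y≡0 b∨c≡M)

    M*b≡d : M * b ≡ d
    M*b≡d = x+y≡d→x+z≡d→y∧z≡0→x≡d (M*x+M*y≡d b∨c≡M b*c≡d)
      (trans (+-comm (M * b) (M * a)) (M*x+M*y≡d a∨b≡M a*b≡d)) (M*x∧M*y≡0 c∨a≡M)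

    d≡0 : d ≡ 0#
    d≡0 = begin
      d              ≡⟨ ∧-idem d ⟨
      d ∧ d          ≡⟨ cong₂ _∧_ M*a≡d M*b≡d ⟨
      M * a ∧ M * b  ≡⟨ M*x∧M*y≡0 a∨b≡M ⟩
      0#             ∎
      where open ≡-Reasoning

mainTheorem2 : {ℓ : Level} (M : ALMonoid ℓ) → let open ALMonoid M in
    (a b c : A) → a * b ≡ b * c → b * c ≡ c * a → (a ≡ b) × (b ≡ c)
mainTheorem2 M a b c a*b≡b*c b*c≡c*a = a≡b , b≡c
  where
  open ALMonoid M
  open ALMonoidProperties.EquilateralTriangle M refl (sym a*b≡b*c) (sym (trans a*b≡b*c b*c≡c*a))
  a≡b : a ≡ b
  a≡b = Equivalence.to (*-zero⇔ a b) d≡0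
  b≡c : b ≡ c
  b≡c = Equivalence.to (*-zero⇔ b c) (trans (sym a*b≡b*c) d≡0)
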